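{- Let $G=(V,E)$ be a finite simple graph of order $n$ and $T$ a positive integer. Let $(x,y,z)$ be a feasible solution of the Time Step Model $\mathrm{TSM}(G,T)$, i.e. $x^t_v\in\{0,1\}$ ($v\in V$, $t\in\{0,\ldots,T\}$), $y^t_a\in\{0,1\}$ ($a\in A$, $t\in[T]$), $z^t\in\{0,1\}$ ($t\in[T]$) satisfying (1) $x^0_v+\sum_{t\in[T]}\sum_{a=(u,v)\in A}y^t_a=1$ for all $v\in V$; (2) $y^t_a\le x^{t-1}_u$ for all $a=(u,v)\in A$, $t\in[T]$; (3) $y^t_a\le x^{t-1}_w$ for all $a=(u,v)\in A$, $w\in N(u)\setminus\{v\}$, $t\in[T]$; (4) $x^t_v=x^{t-1}_v+\sum_{a=(u,v)\in A}y^t_a$ for all $v\in V$, $t\in[T]$; (5) $x^{t-1}_u-x^{t-1}_v+\sum_{w\in N(u)\setminus\{v\}}x^{t-1}_w\le\sum_{a=(w,v)\in A}y^t_a+\deg(u)-1$ for all $(u,v)\in A$, $t\in[T]$; (6) $\frac1n\sum_{v\in V}(x^t_v-x^{t-1}_v)-z^t\le 0$ for all $t\in[T]$; (7) $z^t-\sum_{v\in V}(x^t_v-x^{t-1}_v)\le 0$ for all $t\in[T]$. Then $C=\{v\in V: x^0_v=1\}$ is a zero forcing set corresponding to a zero forcing game in $\mathcal{Z}(G,T)$, and $\operatorname{pt}(G,C)=\sum_{t\in[T]}z^t$.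
   Context: $[T]=\{1,\ldots,T\}$; $N(u)$ is the neighborhood and $\deg(u)=|N(u)|$; $A$ contains both arcs $(u,v),(v,u)$ for each edge $\{u,v\}\in E$. Standard zero forcing rule: a filled vertex $u$ forces a non-filled vertex $v$ if $v$ is the only non-filled neighbor of $u$. A zero forcing game with initial set $C$ consists of sets $C^{(t)}$, $C^{[t]}$ with $C=C^{(0)}=C^{[0]}$, $C^{[t]}=C^{[t-1]}\cup C^{(t)}$, every vertex in exactly one $C^{(t)}$, each $v\in C^{(t)}$ ($t\ge1$) forced by exactly one neighbor $u$ with $u$ and all neighbors of $u$ except $v$ in $C^{[t-1]}$. Here $\mathcal{Z}(G,T)$ denotes the family of zero forcing games whose initial set is a zero forcing set, which use at most $T$ time steps, and in which at each time step all possible forces that can be done independently are applied (i.e. $C^{(t)}$ is the set of all vertices that can be forced at step $t$). $\operatorname{pt}(G,C)$ is the number of time steps needed to fill all vertices from $C$ when at each step all possible forces are applied simultaneously. -}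

module Defs where

open import Data.Nat as ℕ using (ℕ; zero; suc; _∸_)
open import Data.Fin using (Fin; _≟_)
import Data.Fin as Fin
open import Data.Bool using (Bool; true; false; _∧_; _∨_; not; if_then_else_)
open import Data.Integer as ℤ using (ℤ; +_; 0ℤ; 1ℤ; _+_; _-_; _*_; _≤_)
open import Data.Product using (Σ; ∃; _×_; _,_)
open import Data.Empty using (⊥)
open import Relation.Nullary using (¬_; does)
open import Relation.Binary.PropositionalEquality using (_≡_; _≢_)

-- The arc set A consists of all ordered pairs (u , v) with adj u v ≡ true.

record Graph (n : ℕ) : Set where
  field
    adj    : Fin n → Fin n → Bool
    sym    : ∀ u v → adj u v ≡ adj v u
    irrefl : ∀ v → adj v v ≡ false
open Graph public

VSet : ℕ → Set
VSet n = Fin n → Bool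

_∈_ : ∀ {n} → Fin n → VSet n → Set
v ∈ S = S v ≡ true

_∉_ : ∀ {n} → Fin n → VSet n → Set
v ∉ S = ¬ (v ∈ S)

∑ : ∀ {n} → (Fin n → ℤ) → ℤ
∑ {zero}  f = 0ℤ
∑ {suc n} f = f Fin.zero + ∑ (λ i → f (Fin.suc i))

∑T : ℕ → (ℕ → ℤ) → ℤ
∑T zero    f = 0ℤ
∑T (suc T) f = ∑T T f + f (suc T)

degℕ : ∀ {n} → Graph n → Fin n → ℕ
degℕ {zero}  G u = 0
degℕ {suc n} G u = go (adj G u)
  where
  go : ∀ {m} → (Fin m → Bool) → ℕ
  go {zero}  p = 0
  go {suc m} p = (if p Fin.zero then 1 else 0) ℕ.+ go (λ i → p (Fin.suc i))

deg : ∀ {n} → Graph n → Fin n → ℤ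
deg G u = + degℕ G u

Binary : ℤ → Set
Binary a = (a ≡ 0ℤ) Data.Sum.⊎ (a ≡ 1ℤ)
  where import Data.Sum

CanForce : ∀ {n} → Graph n → VSet n → Fin n → Fin n → Set
CanForce G S u v =
  u ∈ S × v ∉ S × adj G u v ≡ true ×
  (∀ w → adj G u w ≡ true → w ≢ v → w ∈ S)

Forceable : ∀ {n} → Graph n → VSet n → Fin n → Set
Forceable G S v = ∃ λ u → CanForce G S u v

allB : ∀ {m} → (Fin m → Bool) → Bool
allB {zero}  p = true
allB {suc m} p = p Fin.zero ∧ allB (λ i → p (Fin.suc i))

anyB : ∀ {m} → (Fin m → Bool) → Bool
anyB {zero}  p = false
anyB {suc m} p = p Fin.zero ∨ anyB (λ i → p (Fin.suc i))

canForceB : ∀ {n} → Graph n → VSet n → Fin n → Fin n → Bool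
canForceB G S u v =
  S u ∧ not (S v) ∧ adj G u v ∧
  allB (λ w → not (adj G u w) ∨ does (w ≟ v) ∨ S w)

step : ∀ {n} → Graph n → VSet n → VSet n
step G S v = S v ∨ anyB (λ u → canForceB G S u v)

fill : ∀ {n} → Graph n → VSet n → ℕ → VSet n
fill G C zero    = C
fill G C (suc k) = step G (fill G C k)

AllFilled : ∀ {n} → VSet n → Set
AllFilled S = ∀ v → v ∈ S

ZeroForcingSet : ∀ {n} → Graph n → VSet n → Set
ZeroForcingSet G C = ∃ λ k → AllFilled (fill G C k)

PropTime : ∀ {n} → Graph n → VSet n → ℕ → Set
PropTime G C k = AllFilled (fill G C k) × (∀ j → j ℕ.< k → ¬ AllFilled (fill G C j))

-- Zero forcing games using at most T time steps.
-- Cs t is C^(t) (only t ∈ {0,…,T} is relevant), forcer t v is the unique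
-- vertex forcing v at time step t.

upto : ∀ {n} → (ℕ → VSet n) → ℕ → VSet n
upto Cs zero    v = Cs zero v
upto Cs (suc t) v = upto Cs t v ∨ Cs (suc t) v

record ZFGame {n} (G : Graph n) (T : ℕ) (C : VSet n) : Set where
  field
    Cs      : ℕ → VSet n
    forcer  : ℕ → Fin n → Fin n
    initial : ∀ v → Cs 0 v ≡ C v
    once    : ∀ v → Σ ℕ λ t → t ℕ.≤ T × v ∈ Cs t ×
                (∀ s → s ℕ.≤ T → v ∈ Cs s → s ≡ t)
    forced  : ∀ t → 1 ℕ.≤ t → t ℕ.≤ T → ∀ v → v ∈ Cs t →
                adj G (forcer t v) v ≡ true ×
                forcer t v ∈ upto Cs (t ∸ 1) ×
                (∀ w → adj G (forcer t v) w ≡ true → w ≢ v → w ∈ upto Cs (t ∸ 1))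

InZ : ∀ {n} → (G : Graph n) → (T : ℕ) → (C : VSet n) → ZFGame G T C → Set
InZ G T C g =
  ZeroForcingSet G C ×
  (∀ t → 1 ℕ.≤ t → t ℕ.≤ T → ∀ v →
     (v ∈ Cs t → Forceable G (upto Cs (t ∸ 1)) v) ×
     (Forceable G (upto Cs (t ∸ 1)) v → v ∈ Cs t))
  where open ZFGame g

-- The Time Step Model TSM(G,T).  x t v = x^t_v, y t u v = y^t_{(u,v)},
-- z t = z^t.  Values outside the index ranges / off the arc set are ignored.

inflow : ∀ {n} → Graph n → (ℕ → Fin n → Fin n → ℤ) → ℕ → Fin n → ℤ
inflow G y t v = ∑ (λ u → if adj G u v then y t u v else 0ℤ)

∑N∖ : ∀ {n} → Graph n → Fin n → Fin n → (Fin n → ℤ) → ℤ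
∑N∖ G u v f = ∑ (λ w → if adj G u w ∧ not (does (w ≟ v)) then f w else 0ℤ)

record TSMFeasible {n} (G : Graph n) (T : ℕ)
       (x : ℕ → Fin n → ℤ) (y : ℕ → Fin n → Fin n → ℤ) (z : ℕ → ℤ) : Set where
  field
    x-bin : ∀ t → t ℕ.≤ T → ∀ v → Binary (x t v)
    y-bin : ∀ t → 1 ℕ.≤ t → t ℕ.≤ T → ∀ u v → adj G u v ≡ true → Binary (y t u v)
    z-bin : ∀ t → 1 ℕ.≤ t → t ℕ.≤ T → Binary (z t)
    c1 : ∀ v → x 0 v + ∑T T (λ t → inflow G y t v) ≡ 1ℤ
    c2 : ∀ u v → adj G u v ≡ true → ∀ t → 1 ℕ.≤ t → t ℕ.≤ T →
           y t u v ≤ x (t ∸ 1) u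
    c3 : ∀ u v → adj G u v ≡ true → ∀ w → adj G u w ≡ true → w ≢ v →
           ∀ t → 1 ℕ.≤ t → t ℕ.≤ T → y t u v ≤ x (t ∸ 1) w
    c4 : ∀ v → ∀ t → 1 ℕ.≤ t → t ℕ.≤ T → x t v ≡ x (t ∸ 1) v + inflow G y t v
    c5 : ∀ u v → adj G u v ≡ true → ∀ t → 1 ℕ.≤ t → t ℕ.≤ T →
           x (t ∸ 1) u - x (t ∸ 1) v + ∑N∖ G u v (x (t ∸ 1))
             ≤ inflow G y t v + deg G u - 1ℤ
    -- (6) multiplied through by n:  Σ_v (x^t_v - x^{t-1}_v) - n z^t ≤ 0
    c6 : ∀ t → 1 ℕ.≤ t → t ℕ.≤ T →
           ∑ (λ v → x t v - x (t ∸ 1) v) - (+ n) * z t ≤ 0ℤ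
    c7 : ∀ t → 1 ℕ.≤ t → t ℕ.≤ T →
           z t - ∑ (λ v → x t v - x (t ∸ 1) v) ≤ 0ℤ

initialSet : ∀ {n} → (ℕ → Fin n → ℤ) → VSet n
initialSet x v = does (x 0 v ℤ.≟ 1ℤ)

-- By induction on t, x^t is the indicator of the set filled after t rounds of
-- simultaneous forcing from C: by (4) x^t adds the inflow of y^t to x^(t-1);
-- (2) and (3) make every arc carrying flow a valid force, and (5) makes every
-- valid force u → v carry flow, because for such u the left-hand side of (5)
-- is 1 + (deg u - 1).  Telescoping (4) and using (1) gives x^T = 1, so C is a
-- zero forcing set, and the sets of newly filled vertices form a game in
-- 𝒵(G,T).  Finally (6) and (7) force z^t = 1 exactly when round t fills some
-- new vertex, which is the case precisely for t ≤ pt(G,C).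

module Submission where

open import Defs hiding (sym)
open import Data.Nat using (ℕ; _≤_; _<_; _∸_; _⊓_; zero; suc; z≤n; s≤s; _≤′_; ≤′-refl; ≤′-step)
import Data.Nat as ℕ
import Data.Nat.Properties as ℕ
open import Data.Fin using (Fin; zero; suc; _≟_)
open import Data.Fin.Properties using (any?; all?; suc-injective)
open import Data.Bool using (Bool; true; false; _∧_; _∨_; not; if_then_else_)
import Data.Bool as Bool
open import Data.Bool.Properties using (∧-conicalˡ; ∧-conicalʳ; ∧-identityʳ; ∨-zeroʳ; ¬-not)
open import Data.Integer using (ℤ; +_; 0ℤ; 1ℤ; _+_; _-_; +≤+)
import Data.Integer as ℤ
import Data.Integer.Properties as ℤ
open import Data.Integer.Solver using (module +-*-Solver)
open import Data.Product using (Σ; ∃; _×_; _,_; proj₂)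
open import Data.Sum using (_⊎_; inj₁; inj₂)
import Data.Sum as ⊎
open import Function using (_∘_; id)
open import Relation.Nullary using (¬_; yes; no; does; contradiction)
open import Relation.Nullary.Decidable using (dec-true; dec-false)
open import Relation.Unary using (Decidable)
open import Relation.Binary.PropositionalEquality
  using (_≡_; _≢_; refl; sym; trans; cong; cong₂; subst; subst₂; _≗_; module ≡-Reasoning)

≡true-ext : ∀ {a b} → (a ≡ true → b ≡ true) → (b ≡ true → a ≡ true) → a ≡ b
≡true-ext {true}          a⇒b _   = sym (a⇒b refl)
≡true-ext {false} {true}  _   b⇒a = b⇒a refl
≡true-ext {false} {false} _   _   = refl

∨-true : ∀ a {b} → a ∨ b ≡ true → a ≡ true ⊎ b ≡ true
∨-true true  _ = inj₁ refl
∨-true false h = inj₂ h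

∧-not⁻ : ∀ a b → a ∧ not b ≡ true → a ≡ true × b ≢ true
∧-not⁻ true false _ = refl , λ ()

∧-not⁺ : ∀ {a b} → a ≡ true → b ≢ true → a ∧ not b ≡ true
∧-not⁺ {b = b} refl b≢true rewrite ¬-not b≢true = refl

∨-∧-not-absorb : ∀ a b → (a ≡ true → b ≡ true) → a ∨ (b ∧ not a) ≡ b
∨-∧-not-absorb true  b a⇒b = sym (a⇒b refl)
∨-∧-not-absorb false b _   = ∧-identityʳ b

allB⁻ : ∀ {m} {p : Fin m → Bool} → allB p ≡ true → ∀ i → p i ≡ true
allB⁻         h zero    = ∧-conicalˡ _ _ h
allB⁻ {p = p} h (suc i) = allB⁻ (∧-conicalʳ (p zero) _ h) i

allB⁺ : ∀ {m} {p : Fin m → Bool} → (∀ i → p i ≡ true) → allB p ≡ true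
allB⁺ {zero}          h = refl
allB⁺ {suc m} {p = p} h rewrite h zero = allB⁺ (h ∘ suc)

anyB⁻ : ∀ {m} {p : Fin m → Bool} → anyB p ≡ true → ∃ λ i → p i ≡ true
anyB⁻ {suc m} {p = p} h with p zero in p0
... | true  = zero , p0
... | false = let (i , pi) = anyB⁻ h in suc i , pi

anyB⁺ : ∀ {m} {p : Fin m → Bool} i → p i ≡ true → anyB p ≡ true
anyB⁺ {p = p} zero    h rewrite h = refl
anyB⁺ {p = p} (suc i) h with p zero
... | true  = refl
... | false = anyB⁺ i h

indicator : Bool → ℤ
indicator b = if b then 1ℤ else 0ℤ

indicator-nonneg : ∀ b → 0ℤ ℤ.≤ indicator b
indicator-nonneg true  = +≤+ z≤n
indicator-nonneg false = +≤+ z≤n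

indicator-≥1 : ∀ {b} → 1ℤ ℤ.≤ indicator b → b ≡ true
indicator-≥1 {true}  _        = refl
indicator-≥1 {false} (+≤+ ())

indicator-diff : ∀ a b → (a ≡ true → b ≡ true) →
                 indicator b - indicator a ≡ indicator (b ∧ not a)
indicator-diff true  true  _   = refl
indicator-diff true  false a⇒b = contradiction (a⇒b refl) λ ()
indicator-diff false true  _   = refl
indicator-diff false false _   = refl

≥1⇒≢0 : ∀ {a} → 1ℤ ℤ.≤ a → a ≢ 0ℤ
≥1⇒≢0 (+≤+ ()) refl

Binary⇒≥0 : ∀ {a} → Binary a → 0ℤ ℤ.≤ a
Binary⇒≥0 (inj₁ refl) = +≤+ z≤n
Binary⇒≥0 (inj₂ refl) = +≤+ z≤n

Binary⇒indicator : ∀ {a b} → Binary a → (a ≢ 0ℤ → b ≡ true) → (b ≡ true → a ≢ 0ℤ) →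
                   a ≡ indicator b
Binary⇒indicator {b = false} (inj₁ refl) _   _   = refl
Binary⇒indicator {b = true}  (inj₁ refl) _   b⇒a = contradiction refl (b⇒a refl)
Binary⇒indicator {b = false} (inj₂ refl) a⇒b _   = contradiction (a⇒b λ ()) λ ()
Binary⇒indicator {b = true}  (inj₂ refl) _   _   = refl

∑-cong : ∀ {m} {f g : Fin m → ℤ} → f ≗ g → ∑ f ≡ ∑ g
∑-cong {zero}  f≗g = refl
∑-cong {suc m} f≗g = cong₂ _+_ (f≗g zero) (∑-cong (f≗g ∘ suc))

∑-nonneg : ∀ {m} {f : Fin m → ℤ} → (∀ i → 0ℤ ℤ.≤ f i) → 0ℤ ℤ.≤ ∑ f
∑-nonneg {zero}  f≥0 = ℤ.≤-refl
∑-nonneg {suc m} f≥0 = ℤ.+-mono-≤ (f≥0 zero) (∑-nonneg (f≥0 ∘ suc))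

term≤∑ : ∀ {m} {f : Fin m → ℤ} → (∀ i → 0ℤ ℤ.≤ f i) → ∀ i → f i ℤ.≤ ∑ f
term≤∑ {suc m} {f} f≥0 zero    = subst (ℤ._≤ ∑ f) (ℤ.+-identityʳ (f zero))
  (ℤ.+-monoʳ-≤ (f zero) (∑-nonneg (f≥0 ∘ suc)))
term≤∑ {suc m} {f} f≥0 (suc i) = subst (ℤ._≤ ∑ f) (ℤ.+-identityˡ (f (suc i)))
  (ℤ.+-mono-≤ (f≥0 zero) (term≤∑ (f≥0 ∘ suc) i))

∑-zero : ∀ {m} {f : Fin m → ℤ} → (∀ i → f i ≡ 0ℤ) → ∑ f ≡ 0ℤ
∑-zero {zero}  f≡0 = refl
∑-zero {suc m} f≡0 = cong₂ _+_ (f≡0 zero) (∑-zero (f≡0 ∘ suc))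

∑≢0⇒∃≢0 : ∀ {m} {f : Fin m → ℤ} → ∑ f ≢ 0ℤ → ∃ λ i → f i ≢ 0ℤ
∑≢0⇒∃≢0 {zero}      ∑f≢0 = contradiction refl ∑f≢0
∑≢0⇒∃≢0 {suc m} {f} ∑f≢0 with f zero ℤ.≟ 0ℤ
... | no  f0≢0 = zero , f0≢0
... | yes f0≡0 =
  let (i , fi≢0) = ∑≢0⇒∃≢0 (∑f≢0 ∘ cong₂ _+_ f0≡0) in suc i , fi≢0

∑-update : ∀ {m} {f g : Fin m → ℤ} v → f v ≡ g v + 1ℤ → (∀ w → w ≢ v → f w ≡ g w) →
           ∑ f ≡ ∑ g + 1ℤ
∑-update {suc m} {f} {g} zero fv others = begin
  f zero + ∑ (f ∘ suc)         ≡⟨ cong₂ _+_ fv (∑-cong λ w → others (suc w) λ ()) ⟩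
  g zero + 1ℤ + ∑ (g ∘ suc)    ≡⟨ ℤ.+-assoc (g zero) 1ℤ _ ⟩
  g zero + (1ℤ + ∑ (g ∘ suc))  ≡⟨ cong (λ r → g zero + r) (ℤ.+-comm 1ℤ (∑ (g ∘ suc))) ⟩
  g zero + (∑ (g ∘ suc) + 1ℤ)  ≡⟨ ℤ.+-assoc (g zero) _ 1ℤ ⟨
  g zero + ∑ (g ∘ suc) + 1ℤ    ∎
  where open ≡-Reasoning
∑-update {suc m} {f} {g} (suc v) fv others = begin
  f zero + ∑ (f ∘ suc)         ≡⟨ cong₂ _+_ (others zero λ ()) (∑-update v fv others-suc) ⟩
  g zero + (∑ (g ∘ suc) + 1ℤ)  ≡⟨ ℤ.+-assoc (g zero) _ 1ℤ ⟨
  g zero + ∑ (g ∘ suc) + 1ℤ    ∎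
  where
  open ≡-Reasoning
  others-suc : ∀ w → w ≢ v → f (suc w) ≡ g (suc w)
  others-suc w w≢v = others (suc w) (w≢v ∘ suc-injective)

∑-indicator-≥1 : ∀ {m} {p : Fin m → Bool} i → p i ≡ true → 1ℤ ℤ.≤ ∑ (indicator ∘ p)
∑-indicator-≥1 {p = p} i pi =
  subst (ℤ._≤ ∑ (indicator ∘ p)) (cong indicator pi) (term≤∑ (indicator-nonneg ∘ p) i)

∑-indicator-0 : ∀ {m} {p : Fin m → Bool} → (∀ i → p i ≢ true) → ∑ (indicator ∘ p) ≡ 0ℤ
∑-indicator-0 none = ∑-zero (cong indicator ∘ ¬-not ∘ none)

∑T-threshold : ∀ {k} {f : ℕ → ℤ} m →
  (∀ t → t < m → t < k → f (suc t) ≡ 1ℤ) → (∀ t → t < m → k ≤ t → f (suc t) ≡ 0ℤ) →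
  ∑T m f ≡ + (m ⊓ k)
∑T-threshold zero _ _ = refl
∑T-threshold {k} {f} (suc m) below above with m ℕ.<? k
... | yes m<k = begin
  ∑T m f + f (suc m)  ≡⟨ cong₂ _+_ (∑T-threshold m below′ above′) (below m ℕ.≤-refl m<k) ⟩
  + (m ⊓ k) + 1ℤ      ≡⟨ cong (λ j → + j + 1ℤ) (ℕ.m≤n⇒m⊓n≡m (ℕ.<⇒≤ m<k)) ⟩
  + m + 1ℤ            ≡⟨ cong +_ (ℕ.+-comm m 1) ⟩
  + suc m             ≡⟨ cong +_ (ℕ.m≤n⇒m⊓n≡m m<k) ⟨
  + (suc m ⊓ k)       ∎
  where
  open ≡-Reasoning
  below′ = λ t t<m → below t (ℕ.m≤n⇒m≤1+n t<m)
  above′ = λ t t<m → above t (ℕ.m≤n⇒m≤1+n t<m)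
... | no m≮k = begin
  ∑T m f + f (suc m)  ≡⟨ cong₂ _+_ (∑T-threshold m below′ above′) (above m ℕ.≤-refl k≤m) ⟩
  + (m ⊓ k) + 0ℤ      ≡⟨ ℤ.+-identityʳ _ ⟩
  + (m ⊓ k)           ≡⟨ cong +_ (ℕ.m≥n⇒m⊓n≡n k≤m) ⟩
  + k                 ≡⟨ cong +_ (ℕ.m≥n⇒m⊓n≡n (ℕ.m≤n⇒m≤1+n k≤m)) ⟨
  + (suc m ⊓ k)       ∎
  where
  open ≡-Reasoning
  k≤m = ℕ.≮⇒≥ m≮k
  below′ = λ t t<m → below t (ℕ.m≤n⇒m≤1+n t<m)
  above′ = λ t t<m → above t (ℕ.m≤n⇒m≤1+n t<m)

IsLeast : (ℕ → Set) → ℕ → Set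
IsLeast P k = P k × (∀ j → j < k → ¬ P j)

IsLeast-unique : ∀ {P k l} → IsLeast P k → IsLeast P l → k ≡ l
IsLeast-unique (pk , k-least) (pl , l-least) =
  ℕ.≤-antisym (ℕ.≮⇒≥ λ l<k → k-least _ l<k pl) (ℕ.≮⇒≥ λ k<l → l-least _ k<l pk)

module _ {P : ℕ → Set} (P? : Decidable P) where

  least-or-none : ∀ N → (∃ λ k → k ≤ N × IsLeast P k) ⊎ (∀ j → j ≤ N → ¬ P j)
  least-or-none zero with P? zero
  ... | yes p0 = inj₁ (0 , z≤n , p0 , λ _ ())
  ... | no ¬p0 = inj₂ λ { zero _ → ¬p0 }
  least-or-none (suc N) with least-or-none N
  ... | inj₁ (k , k≤N , k-least) = inj₁ (k , ℕ.m≤n⇒m≤1+n k≤N , k-least)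
  ... | inj₂ none with P? (suc N)
  ...   | yes p = inj₁ (suc N , ℕ.≤-refl , p , λ j j≤N → none j (ℕ.≤-pred j≤N))
  ...   | no ¬p = inj₂ none-up-to-suc
    where
    none-up-to-suc : ∀ j → j ≤ suc N → ¬ P j
    none-up-to-suc j j≤1+N with ℕ.m≤n⇒m<n∨m≡n j≤1+N
    ... | inj₁ j<1+N = none j (ℕ.≤-pred j<1+N)
    ... | inj₂ refl  = ¬p

  least : ∀ {N} → P N → ∃ λ k → k ≤ N × IsLeast P k
  least {N} pN with least-or-none N
  ... | inj₁ found = found
  ... | inj₂ none  = contradiction pN (none N ℕ.≤-refl)

-- degℕ counts with a function local to its where-block, which cannot be
-- referred to by name; unifying against the two-fold unfolding of degℕ in
-- countAdj-unfold solves the metavariable countAdj to that local function.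
mutual
  private
    countAdj : (k : ℕ) → Graph (suc k) → Fin (suc k) → ∀ {m} → (Fin m → Bool) → ℕ
    countAdj = _

    countAdj-unfold : ∀ k (G : Graph (suc (suc k))) u → degℕ G u ≡
      (if adj G u zero then 1 else 0) ℕ.+
      ((if adj G u (suc zero) then 1 else 0) ℕ.+
       countAdj (suc k) G u (λ i → adj G u (suc (suc i))))
    countAdj-unfold k G u
      with suc k | G | u | adj G u zero | adj G u (suc zero) | (λ i → adj G u (suc (suc i)))
    ... | _ | _ | _ | _ | _ | _ = refl

countAdj≡∑ : ∀ {k} (G : Graph (suc k)) u {m} (p : Fin m → Bool) →
             + countAdj k G u p ≡ ∑ (indicator ∘ p)
countAdj≡∑ G u {zero}  p = refl
countAdj≡∑ G u {suc m} p with p zero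
... | true  = cong (λ s → 1ℤ + s) (countAdj≡∑ G u (p ∘ suc))
... | false = trans (countAdj≡∑ G u (p ∘ suc)) (sym (ℤ.+-identityˡ _))

deg≡∑adj : ∀ {n} (G : Graph n) u → deg G u ≡ ∑ (indicator ∘ adj G u)
deg≡∑adj {suc k} G u = countAdj≡∑ G u (adj G u)

module _ {n} (G : Graph n) where

  ∑N∖-cong : ∀ {u v} {f g : Fin n → ℤ} → (∀ w → adj G u w ≡ true → w ≢ v → f w ≡ g w) →
             ∑N∖ G u v f ≡ ∑N∖ G u v g
  ∑N∖-cong {u} {v} {f} {g} f≡g = ∑-cong pointwise
    where
    pointwise : ∀ w → (if adj G u w ∧ not (does (w ≟ v)) then f w else 0ℤ)
                    ≡ (if adj G u w ∧ not (does (w ≟ v)) then g w else 0ℤ)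
    pointwise w with adj G u w in uw | w ≟ v
    ... | false | _      = refl
    ... | true  | yes _  = refl
    ... | true  | no w≢v = f≡g w uw w≢v

  ∑N∖-ones : ∀ {u v} → adj G u v ≡ true → ∑N∖ G u v (λ _ → 1ℤ) + 1ℤ ≡ deg G u
  ∑N∖-ones {u} {v} uv = sym (trans (deg≡∑adj G u) (∑-update v at-v elsewhere))
    where
    at-v : indicator (adj G u v) ≡ indicator (adj G u v ∧ not (does (v ≟ v))) + 1ℤ
    at-v rewrite uv | dec-true (v ≟ v) refl = refl
    elsewhere : ∀ w → w ≢ v →
                indicator (adj G u w) ≡ indicator (adj G u w ∧ not (does (w ≟ v)))
    elsewhere w w≢v rewrite dec-false (w ≟ v) w≢v = cong indicator (sym (∧-identityʳ _))

  canForceB⁻ : ∀ {S u v} → canForceB G S u v ≡ true → CanForce G S u v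
  canForceB⁻ {S} {u} {v} h with S u | S v | adj G u v
  canForceB⁻             () | false | _     | _
  canForceB⁻             () | true  | true  | _
  canForceB⁻             () | true  | false | false
  canForceB⁻ {S} {u} {v} h  | true  | false | true = refl , (λ ()) , refl , neighbours
    where
    neighbours : ∀ w → adj G u w ≡ true → w ≢ v → w ∈ S
    neighbours w uw w≢v with allB⁻ h w
    ... | clause rewrite uw | dec-false (w ≟ v) w≢v = clause

  canForceB⁺ : ∀ {S u v} → CanForce G S u v → canForceB G S u v ≡ true
  canForceB⁺ {S} {u} {v} (u∈S , v∉S , uv , neighbours)
    rewrite u∈S | ¬-not v∉S | uv = allB⁺ clause
    where
    clause : ∀ w → not (adj G u w) ∨ does (w ≟ v) ∨ S w ≡ true
    clause w with adj G u w in uw | w ≟ v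
    ... | false | _      = refl
    ... | true  | yes _  = refl
    ... | true  | no w≢v = neighbours w uw w≢v

  step⁻ : ∀ S {v} → v ∈ step G S → v ∈ S ⊎ Forceable G S v
  step⁻ S {v} h = ⊎.map₂ forceable (∨-true (S v) h)
    where
    forceable : anyB (λ u → canForceB G S u v) ≡ true → Forceable G S v
    forceable some = let (u , cf) = anyB⁻ some in u , canForceB⁻ cf

  step⁺ : ∀ S {v} → v ∈ S ⊎ Forceable G S v → v ∈ step G S
  step⁺ S {v} (inj₁ v∈S)      rewrite v∈S = refl
  step⁺ S {v} (inj₂ (u , cf)) = trans (cong (S v ∨_) (anyB⁺ u (canForceB⁺ cf))) (∨-zeroʳ (S v))

  CanForce-cong : ∀ {S S′ u v} → S ≗ S′ → CanForce G S u v → CanForce G S′ u v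
  CanForce-cong {u = u} {v} S≗S′ (u∈S , v∉S , uv , neighbours) =
    trans (sym (S≗S′ u)) u∈S , v∉S ∘ trans (S≗S′ v) , uv ,
    λ w uw w≢v → trans (sym (S≗S′ w)) (neighbours w uw w≢v)

  Forceable-cong : ∀ {S S′ v} → S ≗ S′ → Forceable G S v → Forceable G S′ v
  Forceable-cong S≗S′ (u , cf) = u , CanForce-cong S≗S′ cf

  step-cong : ∀ {S S′} → S ≗ S′ → step G S ≗ step G S′
  step-cong {S} {S′} S≗S′ v = ≡true-ext
    (step⁺ S′ ∘ ⊎.map (trans (sym (S≗S′ v))) (Forceable-cong S≗S′) ∘ step⁻ S)
    (step⁺ S ∘ ⊎.map (trans (S≗S′ v)) (Forceable-cong (sym ∘ S≗S′)) ∘ step⁻ S′)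

  chooseForcer : VSet n → Fin n → Fin n
  chooseForcer S v with any? (λ u → canForceB G S u v Bool.≟ true)
  ... | yes (u , _) = u
  ... | no _        = v

  chooseForcer-forces : ∀ {S v} → Forceable G S v → CanForce G S (chooseForcer S v) v
  chooseForcer-forces {S} {v} (u , cf) with any? (λ u → canForceB G S u v Bool.≟ true)
  ... | yes (_ , cf′) = canForceB⁻ cf′
  ... | no none       = contradiction (u , canForceB⁺ cf) none

  module _ (C : VSet n) where

    fill-suc⊇ : ∀ t v → v ∈ fill G C t → v ∈ fill G C (suc t)
    fill-suc⊇ t v = step⁺ (fill G C t) ∘ inj₁

    fill-mono′ : ∀ {i j} → i ≤′ j → ∀ v → v ∈ fill G C i → v ∈ fill G C j
    fill-mono′ ≤′-refl            v = id
    fill-mono′ (≤′-step {j} i≤′j) v = fill-suc⊇ j v ∘ fill-mono′ i≤′j v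

    fill-mono : ∀ {i j} → i ≤ j → ∀ v → v ∈ fill G C i → v ∈ fill G C j
    fill-mono = fill-mono′ ∘ ℕ.≤⇒≤′

    fill-fixed′ : ∀ {t j} → fill G C (suc t) ≗ fill G C t → t ≤′ j → fill G C j ≗ fill G C t
    fill-fixed′ fixed ≤′-refl          = λ _ → refl
    fill-fixed′ fixed (≤′-step t≤′j) v = trans (step-cong (fill-fixed′ fixed t≤′j) v) (fixed v)

    fill-fixed : ∀ {t j} → fill G C (suc t) ≗ fill G C t → t ≤ j → fill G C j ≗ fill G C t
    fill-fixed fixed = fill-fixed′ fixed ∘ ℕ.≤⇒≤′

    newly : ℕ → VSet n
    newly zero      = C
    newly (suc t) v = fill G C (suc t) v ∧ not (fill G C t v)

    upto-newly : ∀ t → upto newly t ≗ fill G C t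
    upto-newly zero    v = refl
    upto-newly (suc t) v =
      trans (cong (_∨ newly (suc t) v) (upto-newly t v))
            (∨-∧-not-absorb (fill G C t v) (fill G C (suc t) v) (fill-suc⊇ t v))

    newly-suc⁻ : ∀ t v → v ∈ newly (suc t) → v ∈ fill G C (suc t) × v ∉ fill G C t
    newly-suc⁻ t v = ∧-not⁻ (fill G C (suc t) v) (fill G C t v)

    newly-suc⇒Forceable : ∀ t v → v ∈ newly (suc t) → Forceable G (fill G C t) v
    newly-suc⇒Forceable t v v∈ with newly-suc⁻ t v v∈
    ... | v∈fill-suc , v∉fill with step⁻ (fill G C t) v∈fill-suc
    ...   | inj₁ v∈fill    = contradiction v∈fill v∉fill
    ...   | inj₂ forceable = forceable

    Forceable⇒newly-suc : ∀ t v → Forceable G (fill G C t) v → v ∈ newly (suc t)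
    Forceable⇒newly-suc t v forceable@(_ , _ , v∉fill , _) =
      ∧-not⁺ (step⁺ (fill G C t) (inj₂ forceable)) v∉fill

    FirstFilledAt : Fin n → ℕ → Set
    FirstFilledAt v = IsLeast (λ j → v ∈ fill G C j)

    newly⇒FirstFilledAt : ∀ t v → v ∈ newly t → FirstFilledAt v t
    newly⇒FirstFilledAt zero    v v∈C = v∈C , λ _ ()
    newly⇒FirstFilledAt (suc t) v v∈  =
      let (v∈fill-suc , v∉fill) = newly-suc⁻ t v v∈
      in v∈fill-suc , λ j j<1+t v∈fill-j → v∉fill (fill-mono (ℕ.≤-pred j<1+t) v v∈fill-j)

    FirstFilledAt⇒newly : ∀ t v → FirstFilledAt v t → v ∈ newly t
    FirstFilledAt⇒newly zero    v (v∈C , _)              = v∈C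
    FirstFilledAt⇒newly (suc t) v (v∈fill-suc , earlier) = ∧-not⁺ v∈fill-suc (earlier t ℕ.≤-refl)

    propTime : ∀ {N} → AllFilled (fill G C N) → ∃ λ k → k ≤ N × PropTime G C k
    propTime = least (λ j → all? (λ v → fill G C j v Bool.≟ true))

    newly-before-propTime : ∀ {k t} → PropTime G C k → t < k → ∃ λ v → v ∈ newly (suc t)
    newly-before-propTime {k} {t} (full , earlier) t<k
      with any? (λ v → newly (suc t) v Bool.≟ true)
    ... | yes found = found
    ... | no  none  = contradiction full-at-t (earlier t t<k)
      where
      no-growth : ∀ v → v ∈ fill G C (suc t) → v ∈ fill G C t
      no-growth v v∈ with fill G C t v Bool.≟ true
      ... | yes v∈fill = v∈fill
      ... | no  v∉fill = contradiction (v , ∧-not⁺ v∈ v∉fill) none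
      fixed : fill G C (suc t) ≗ fill G C t
      fixed v = ≡true-ext (no-growth v) (fill-suc⊇ t v)
      full-at-t : AllFilled (fill G C t)
      full-at-t v = trans (sym (fill-fixed fixed (ℕ.<⇒≤ t<k) v)) (full v)

    no-newly-after-propTime : ∀ {k t} → PropTime G C k → k ≤ t → ∀ v → v ∉ newly (suc t)
    no-newly-after-propTime {t = t} (full , _) k≤t v v∈ =
      proj₂ (newly-suc⁻ t v v∈) (fill-mono k≤t v (full v))

    simultaneousGame : ∀ {N} → AllFilled (fill G C N) → Σ (ZFGame G N C) (InZ G N C)
    simultaneousGame {N} full = game , (N , full) , newly⇔Forceable
      where
      once : ∀ v → Σ ℕ λ t → t ≤ N × v ∈ newly t × (∀ s → s ≤ N → v ∈ newly s → s ≡ t)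
      once v =
        let (t , t≤N , first) = least (λ j → fill G C j v Bool.≟ true) (full v)
        in t , t≤N , FirstFilledAt⇒newly t v first ,
           λ s _ v∈ → IsLeast-unique (newly⇒FirstFilledAt s v v∈) first

      forcer : ℕ → Fin n → Fin n
      forcer t = chooseForcer (fill G C (t ∸ 1))

      forced : ∀ t → 1 ≤ t → t ≤ N → ∀ v → v ∈ newly t →
                 adj G (forcer t v) v ≡ true × forcer t v ∈ upto newly (t ∸ 1) ×
                 (∀ w → adj G (forcer t v) w ≡ true → w ≢ v → w ∈ upto newly (t ∸ 1))
      forced (suc t) _ _ v v∈ =
        let (u∈ , _ , uv , neighbours) = CanForce-cong (sym ∘ upto-newly t)
                                           (chooseForcer-forces (newly-suc⇒Forceable t v v∈))
        in uv , u∈ , neighbours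

      game : ZFGame G N C
      game = record
        { Cs = newly ; forcer = forcer ; initial = λ _ → refl ; once = once ; forced = forced }

      newly⇔Forceable : ∀ t → 1 ≤ t → t ≤ N → ∀ v →
        (v ∈ newly t → Forceable G (upto newly (t ∸ 1)) v) ×
        (Forceable G (upto newly (t ∸ 1)) v → v ∈ newly t)
      newly⇔Forceable (suc t) _ _ v =
        Forceable-cong (sym ∘ upto-newly t) ∘ newly-suc⇒Forceable t v ,
        Forceable⇒newly-suc t v ∘ Forceable-cong (upto-newly t)

module TimeStepModel {n} {G : Graph n} {T} {x : ℕ → Fin n → ℤ} {y : ℕ → Fin n → Fin n → ℤ}
                     {z : ℕ → ℤ} (F : TSMFeasible G T x y z) where
  open TSMFeasible F

  C : VSet n
  C = initialSet x

  x₀≡indicator : ∀ v → x 0 v ≡ indicator (C v)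
  x₀≡indicator v with x 0 v | x-bin 0 z≤n v
  ... | _ | inj₁ refl = refl
  ... | _ | inj₂ refl = refl

  inflow-nonneg : ∀ t → 1 ≤ t → t ≤ T → ∀ v → 0ℤ ℤ.≤ inflow G y t v
  inflow-nonneg t 1≤t t≤T v = ∑-nonneg term-nonneg
    where
    term-nonneg : ∀ u → 0ℤ ℤ.≤ (if adj G u v then y t u v else 0ℤ)
    term-nonneg u with adj G u v in uv
    ... | true  = Binary⇒≥0 (y-bin t 1≤t t≤T u v uv)
    ... | false = ℤ.≤-refl

  inflow≢0⇒arc : ∀ t → 1 ≤ t → t ≤ T → ∀ v → inflow G y t v ≢ 0ℤ →
                 ∃ λ u → adj G u v ≡ true × y t u v ≡ 1ℤ
  inflow≢0⇒arc t 1≤t t≤T v inflow≢0 with ∑≢0⇒∃≢0 inflow≢0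
  ... | u , term≢0 with adj G u v in uv
  ...   | false = contradiction refl term≢0
  ...   | true with y-bin t 1≤t t≤T u v uv
  ...     | inj₁ y≡0 = contradiction y≡0 term≢0
  ...     | inj₂ y≡1 = u , uv , y≡1

  module Step {t} (t<T : t < T) (S : VSet n) (x≡S : ∀ v → x t v ≡ indicator (S v)) where

    I : Fin n → ℤ
    I = inflow G y (suc t)

    x-suc : ∀ v → x (suc t) v ≡ indicator (S v) + I v
    x-suc v = trans (c4 v (suc t) (s≤s z≤n) t<T) (cong (_+ I v) (x≡S v))

    Forceable⇒I≥1 : ∀ {v} → Forceable G S v → 1ℤ ℤ.≤ I v
    Forceable⇒I≥1 {v} (u , u∈S , v∉S , uv , neighbours) =
      cancel (I v) (∑N∖ G u v (λ _ → 1ℤ)) (subst₂ ℤ._≤_ lhs rhs (c5 u v uv (suc t) (s≤s z≤n) t<T))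
      where
      cancel : ∀ i s → 1ℤ - 0ℤ + s ℤ.≤ i + (s + 1ℤ) - 1ℤ → 1ℤ ℤ.≤ i
      cancel i s h = ℤ.0≤i-j⇒j≤i (subst (0ℤ ℤ.≤_) simplify (ℤ.i≤j⇒0≤j-i h))
        where
        open +-*-Solver
        simplify : i + (s + 1ℤ) - 1ℤ - (1ℤ - 0ℤ + s) ≡ i - 1ℤ
        simplify = solve 2 (λ i s → i :+ (s :+ con 1ℤ) :- con 1ℤ :- (con 1ℤ :- con 0ℤ :+ s)
                                    := i :- con 1ℤ) refl i s
      lhs : x t u - x t v + ∑N∖ G u v (x t) ≡ 1ℤ - 0ℤ + ∑N∖ G u v (λ _ → 1ℤ)
      lhs = cong₂ _+_ (cong₂ _-_ (trans (x≡S u) (cong indicator u∈S))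
                                 (trans (x≡S v) (cong indicator (¬-not v∉S))))
                      (∑N∖-cong G λ w uw w≢v →
                         trans (x≡S w) (cong indicator (neighbours w uw w≢v)))
      rhs : I v + deg G u - 1ℤ ≡ I v + (∑N∖ G u v (λ _ → 1ℤ) + 1ℤ) - 1ℤ
      rhs = cong (λ d → I v + d - 1ℤ) (sym (∑N∖-ones G uv))

    I≢0⇒Forceable : ∀ {v} → v ∉ S → I v ≢ 0ℤ → Forceable G S v
    I≢0⇒Forceable {v} v∉S I≢0 with inflow≢0⇒arc (suc t) (s≤s z≤n) t<T v I≢0
    ... | u , uv , y≡1 =
      u , filled (c2 u v uv (suc t) (s≤s z≤n) t<T) , v∉S , uv ,
      λ w uw w≢v → filled (c3 u v uv w uw w≢v (suc t) (s≤s z≤n) t<T)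
      where
      filled : ∀ {w} → y (suc t) u v ℤ.≤ x t w → w ∈ S
      filled {w} y≤x = indicator-≥1 (subst₂ ℤ._≤_ y≡1 (x≡S w) y≤x)

    x-suc≡indicator-step : ∀ v → x (suc t) v ≡ indicator (step G S v)
    x-suc≡indicator-step v = Binary⇒indicator (x-bin (suc t) t<T v) nonzero⇒step step⇒nonzero
      where
      x-suc-if : ∀ {b} → S v ≡ b → x (suc t) v ≡ indicator b + I v
      x-suc-if Sv≡b = trans (x-suc v) (cong (λ b → indicator b + I v) Sv≡b)

      nonzero⇒step : x (suc t) v ≢ 0ℤ → v ∈ step G S
      nonzero⇒step x≢0 with S v Bool.≟ true
      ... | yes v∈S = step⁺ G S (inj₁ v∈S)
      ... | no  v∉S = step⁺ G S (inj₂ (I≢0⇒Forceable v∉S λ I≡0 →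
                        x≢0 (trans (x-suc-if (¬-not v∉S)) (cong (λ i → 0ℤ + i) I≡0))))

      step⇒nonzero : v ∈ step G S → x (suc t) v ≢ 0ℤ
      step⇒nonzero v∈ with step⁻ G S v∈
      ... | inj₁ v∈S = ≥1⇒≢0 (subst (1ℤ ℤ.≤_) (sym (x-suc-if v∈S))
                         (ℤ.+-monoʳ-≤ 1ℤ (inflow-nonneg (suc t) (s≤s z≤n) t<T v)))
      ... | inj₂ forceable@(_ , _ , v∉S , _) =
        ≥1⇒≢0 (subst (1ℤ ℤ.≤_) (sym (trans (x-suc-if (¬-not v∉S)) (ℤ.+-identityˡ (I v))))
                 (Forceable⇒I≥1 forceable))

  x≡indicator-fill : ∀ t → t ≤ T → ∀ v → x t v ≡ indicator (fill G C t v)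
  x≡indicator-fill zero    _   = x₀≡indicator
  x≡indicator-fill (suc t) t<T =
    Step.x-suc≡indicator-step t<T (fill G C t) (x≡indicator-fill t (ℕ.<⇒≤ t<T))

  x-telescope : ∀ t → t ≤ T → ∀ v → x t v ≡ x 0 v + ∑T t (λ s → inflow G y s v)
  x-telescope zero    _   v = sym (ℤ.+-identityʳ (x 0 v))
  x-telescope (suc t) t<T v = begin
    x (suc t) v                                  ≡⟨ c4 v (suc t) (s≤s z≤n) t<T ⟩
    x t v + I                                    ≡⟨ cong (_+ I) (x-telescope t (ℕ.<⇒≤ t<T) v) ⟩
    x 0 v + ∑T t (λ s → inflow G y s v) + I      ≡⟨ ℤ.+-assoc (x 0 v) _ I ⟩
    x 0 v + ∑T (suc t) (λ s → inflow G y s v)    ∎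
    where
    open ≡-Reasoning
    I = inflow G y (suc t) v

  fill-complete : AllFilled (fill G C T)
  fill-complete v = indicator-≥1 (ℤ.≤-reflexive (begin
    1ℤ                                    ≡⟨ c1 v ⟨
    x 0 v + ∑T T (λ t → inflow G y t v)  ≡⟨ x-telescope T ℕ.≤-refl v ⟨
    x T v                                 ≡⟨ x≡indicator-fill T ℕ.≤-refl v ⟩
    indicator (fill G C T v)              ∎))
    where open ≡-Reasoning

  ∑Δx≡∑newly : ∀ {t} → t < T →
               ∑ (λ v → x (suc t) v - x t v) ≡ ∑ (indicator ∘ newly G C (suc t))
  ∑Δx≡∑newly {t} t<T = ∑-cong λ v → begin
    x (suc t) v - x t v
      ≡⟨ cong₂ _-_ (x≡indicator-fill (suc t) t<T v) (x≡indicator-fill t (ℕ.<⇒≤ t<T) v) ⟩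
    indicator (fill G C (suc t) v) - indicator (fill G C t v)
      ≡⟨ indicator-diff _ _ (fill-suc⊇ G C t v) ⟩
    indicator (newly G C (suc t) v)
      ∎
    where open ≡-Reasoning

  z≡1-if-newly : ∀ {t} → t < T → (∃ λ v → v ∈ newly G C (suc t)) → z (suc t) ≡ 1ℤ
  z≡1-if-newly {t} t<T (v , v∈) with z-bin (suc t) (s≤s z≤n) t<T
  ... | inj₂ z≡1 = z≡1
  ... | inj₁ z≡0 = contradiction (ℤ.≤-trans Δ≥1 Δ≤0) λ { (+≤+ ()) }
    where
    Δ = ∑ (λ v → x (suc t) v - x t v)
    Δ≥1 : 1ℤ ℤ.≤ Δ
    Δ≥1 = subst (1ℤ ℤ.≤_) (sym (∑Δx≡∑newly t<T)) (∑-indicator-≥1 v v∈)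
    Δ≤0 : Δ ℤ.≤ 0ℤ
    Δ≤0 = subst (Δ ℤ.≤_) (trans (cong (+ n ℤ.*_) z≡0) (ℤ.*-zeroʳ (+ n)))
            (ℤ.i-j≤0⇒i≤j (c6 (suc t) (s≤s z≤n) t<T))

  z≡0-if-none-newly : ∀ {t} → t < T → (∀ v → v ∉ newly G C (suc t)) → z (suc t) ≡ 0ℤ
  z≡0-if-none-newly {t} t<T none with z-bin (suc t) (s≤s z≤n) t<T
  ... | inj₁ z≡0 = z≡0
  ... | inj₂ z≡1 = contradiction (subst₂ ℤ._≤_ z≡1 Δ≡0 z≤Δ) λ { (+≤+ ()) }
    where
    z≤Δ = ℤ.i-j≤0⇒i≤j (c7 (suc t) (s≤s z≤n) t<T)
    Δ≡0 = trans (∑Δx≡∑newly t<T) (∑-indicator-0 none)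

  ∑z≡propTime : ∀ {k} → PropTime G C k → k ≤ T → ∑T T z ≡ + k
  ∑z≡propTime {k} pt k≤T = trans (∑T-threshold T before after) (cong +_ (ℕ.m≥n⇒m⊓n≡n k≤T))
    where
    before = λ t t<T t<k → z≡1-if-newly t<T (newly-before-propTime G C pt t<k)
    after  = λ t t<T k≤t → z≡0-if-none-newly t<T (no-newly-after-propTime G C pt k≤t)

theorem4p2 : (n : ℕ) (G : Graph n) (T : ℕ) → 1 ≤ T →
    (x : ℕ → Fin n → ℤ) (y : ℕ → Fin n → Fin n → ℤ) (z : ℕ → ℤ) →
    TSMFeasible G T x y z →
    ZeroForcingSet G (initialSet x) ×
    Σ (ZFGame G T (initialSet x)) (InZ G T (initialSet x)) ×
    Σ ℕ (λ k → PropTime G (initialSet x) k × ∑T T z ≡ + k)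
theorem4p2 n G T _ x y z F =
  let (k , k≤T , pt) = propTime G C fill-complete
  in (T , fill-complete) , simultaneousGame G C fill-complete , (k , pt , ∑z≡propTime pt k≤T)
  where open TimeStepModel F
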